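{- Let $G$ and $H$ be finite simple graphs. If $G\in \mathrm{Expand}(H)$, then $\alpha^{*}(G|H)\le 1$.
   Context: $\alpha(X)$ is the independence number. The strong product $G \boxtimes W$ has vertex set $V(G)\times V(W)$, with distinct $(u_1,v_1),(u_2,v_2)$ adjacent iff ($u_1=u_2$ or $u_1u_2\in E(G)$) and ($v_1=v_2$ or $v_1v_2\in E(W)$). $\alpha^{*}(G|H)=\sup_{W} \frac{\alpha(G\boxtimes W)}{\alpha(H\boxtimes W)}$ over all finite simple graphs $W$ with at least one vertex. For a graph $H$, $\mathrm{Expand}(H)$ is the set of all graphs (up to isomorphism) obtainable from $H$ by a finite sequence (possibly empty) of the following operations: (1) delete a vertex; (2) add a new edge; (3) replace a vertex $v$ by a clique of some size $k\ge 1$, each of whose $k$ new vertices is joined to all neighbors of $v$. -}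

module Defs where

open import Data.Bool using (Bool; true; false; _∧_; _∨_; not; if_then_else_)
open import Data.Nat using (ℕ; zero; suc; _*_; _⊔_; _≤_)
open import Data.Fin using (Fin; remQuot; _≟_)
open import Data.Fin.Subset using (Subset; ∣_∣)
open import Data.List using (List; []; _∷_; map; _++_; foldr; allFin)
open import Data.Bool.ListAction using (all)
open import Data.Vec using (Vec; lookup) renaming ([] to []ᵥ; _∷_ to _∷ᵥ_)
open import Data.Product using (Σ; ∃; _×_; _,_; proj₁; proj₂)
open import Data.Sum using (_⊎_)
open import Relation.Nullary using (¬_)
open import Relation.Nullary.Decidable using (⌊_⌋)
open import Relation.Binary.PropositionalEquality using (_≡_; _≢_)
open import Function.Bundles using (_↔_; Inverse)

record Graph : Set where
  field
    n      : ℕ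
    adj    : Fin n → Fin n → Bool
    sym    : ∀ i j → adj i j ≡ adj j i
    irrefl : ∀ i → adj i i ≡ false
open Graph public

_==_ : ∀ {k} → Fin k → Fin k → Bool
i == j = ⌊ i ≟ j ⌋

subsets : ∀ k → List (Subset k)
subsets zero    = []ᵥ ∷ []
subsets (suc k) = map (true ∷ᵥ_) (subsets k) ++ map (false ∷ᵥ_) (subsets k)

independent? : ∀ {k} → (Fin k → Fin k → Bool) → Subset k → Bool
independent? {k} a S =
  all (λ i → all (λ j → not (lookup S i ∧ lookup S j ∧ a i j)) (allFin k)) (allFin k)

αRaw : ∀ k → (Fin k → Fin k → Bool) → ℕ
αRaw k a = foldr _⊔_ 0
  (map (λ S → if independent? a S then ∣ S ∣ else 0) (subsets k))

α : Graph → ℕ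
α G = αRaw (n G) (adj G)

⊠adj : (G W : Graph) → Fin (n G * n W) → Fin (n G * n W) → Bool
⊠adj G W p q with remQuot {n G} (n W) p | remQuot {n G} (n W) q
... | (u₁ , v₁) | (u₂ , v₂) =
  not (p == q) ∧ ((u₁ == u₂) ∨ adj G u₁ u₂) ∧ ((v₁ == v₂) ∨ adj W v₁ v₂)

α⊠ : Graph → Graph → ℕ
α⊠ G W = αRaw (n G * n W) (⊠adj G W)

Iso : Graph → Graph → Set
Iso G G' = Σ (Fin (n G) ↔ Fin (n G')) λ f →
  ∀ i j → adj G' (Inverse.to f i) (Inverse.to f j) ≡ adj G i j

DeleteVertex : Graph → Graph → Set
DeleteVertex G G' = Σ (Fin (n G)) λ v → Σ (Fin (n G') → Fin (n G)) λ ι →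
  (∀ x y → ι x ≡ ι y → x ≡ y) ×
  (∀ x → ι x ≢ v) ×
  (∀ u → u ≢ v → ∃ λ x → ι x ≡ u) ×
  (∀ x y → adj G' x y ≡ adj G (ι x) (ι y))

AddEdge : Graph → Graph → Set
AddEdge G G' = Σ (n G ≡ n G') λ { _≡_.refl →
  Σ (Fin (n G)) λ u → Σ (Fin (n G)) λ v →
  u ≢ v × adj G u v ≡ false ×
  (∀ i j → adj G' i j ≡ (adj G i j ∨ ((i == u) ∧ (j == v)) ∨ ((i == v) ∧ (j == u)))) }

-- (3) replace v by a clique of size k ≥ 1 whose vertices are all joined
--     to all neighbours of v.  Encoded by a projection π : V(G') → V(G)
--     which is surjective (so the clique is nonempty, k ≥ 1), whose
--     fibres over u ≠ v are singletons (the fibre over v is the clique),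
--     and with adjacency: distinct x, y adjacent iff π x = π y (both in
--     the clique) or π x π y ∈ E(G).
ReplaceByClique : Graph → Graph → Set
ReplaceByClique G G' = Σ (Fin (n G)) λ v → Σ (Fin (n G') → Fin (n G)) λ π →
  (∀ u → ∃ λ x → π x ≡ u) ×
  (∀ x y → π x ≡ π y → π x ≢ v → x ≡ y) ×
  (∀ x y → x ≢ y → adj G' x y ≡ ((π x == π y) ∨ adj G (π x) (π y)))

data Expand (H : Graph) : Graph → Set where
  base   : Expand H H
  iso    : ∀ {G G'} → Expand H G → Iso G G' → Expand H G'
  delete : ∀ {G G'} → Expand H G → DeleteVertex G G' → Expand H G'
  addE   : ∀ {G G'} → Expand H G → AddEdge G G' → Expand H G'
  clique : ∀ {G G'} → Expand H G → ReplaceByClique G G' → Expand H G'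

-- α*(G|H) ≤ 1, i.e. sup_W α(G ⊠ W)/α(H ⊠ W) ≤ 1, i.e. for every finite
-- simple graph W with at least one vertex, α(G ⊠ W) ≤ α(H ⊠ W).
α*≤1 : Graph → Graph → Set
α*≤1 G H = ∀ (W : Graph) → 1 ≤ n W → α⊠ G W ≤ α⊠ H W

{-# OPTIONS --safe #-}

-- Each expansion step G ↦ G′ comes with a map V(G′) → V(G) whose fibres
-- are cliques of G′ and which reflects adjacency, i.e. a homomorphism from
-- the complement of G′ to the complement of G.  Such a map is injective on
-- every independent set of G′ and sends it to an independent set of G, so
-- α(G′) ≤ α(G).  Taking its product with the identity of W gives such a map
-- G′ ⊠ W → G ⊠ W, hence α(G′ ⊠ W) ≤ α(G ⊠ W) along every step.

module Submission where

open import Defs hiding (sym)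
open import Data.Bool using (Bool; true; false; T; not; _∧_; _∨_; if_then_else_)
open import Data.Bool.Properties using (T-∧; T-∨)
open import Data.Nat using (ℕ; _*_; _⊔_; _≤_; z≤n; s≤s)
open import Data.Nat.Properties using (≤-refl; ≤-trans; ⊔-lub; m≤n⇒m≤n⊔o; m≤n⇒m≤o⊔n)
open import Data.Fin using (Fin; zero; suc; remQuot; combine; _≟_)
open import Data.Fin.Properties using (remQuot-combine; suc-injective; 0≢1+n)
open import Data.Fin.Subset using (Subset; inside; outside; ⊥; ⁅_⁆; _∪_; _-_; _∈_; ∣_∣)
open import Data.Fin.Subset.Properties
  using (∉⊥; x∈⁅x⁆; x∈⁅y⁆⇒x≡y; p⊆p∪q; q⊆p∪q; x∈p∪q⁻; x∈p∧x≢y⇒x∈p-y; x∈p⇒∣p-x∣<∣p∣)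
open import Data.List using (allFin)
open import Data.List.Properties using (foldr-preservesᵇ; foldr-preservesᵒ)
open import Data.List.Membership.Propositional as List using (lose)
open import Data.List.Membership.Propositional.Properties using (∈-allFin; ∈-map⁺; ∈-++⁺ˡ; ∈-++⁺ʳ)
open import Data.List.Relation.Unary.All as All using ()
open import Data.List.Relation.Unary.All.Properties using (all⁺; all⁻) renaming (map⁺ to All-map⁺)
open import Data.List.Relation.Unary.Any as Any using ()
open import Data.List.Relation.Unary.Any.Properties using () renaming (map⁺ to Any-map⁺)
open import Data.Vec using ([]; _∷_; lookup; here; there)
open import Data.Vec.Properties using ([]=⇒lookup; lookup⇒[]=)
open import Data.Product using (∃; _×_; _,_; proj₁; proj₂)
open import Data.Product.Function.NonDependent.Propositional using (_×-⇔_)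
open import Data.Sum using (_⊎_; inj₁; inj₂; [_,_])
open import Data.Sum.Function.Propositional using (_⊎-⇔_)
open import Function using (_∘_; id; _⇔_; mk⇔; Inverse; Equivalence)
open import Function.Construct.Identity using (⇔-id)
open import Function.Construct.Composition using (_⇔-∘_)
open import Relation.Nullary using (¬_; contradiction)
open import Relation.Nullary.Decidable using (toSum; fromWitness; toWitness; fromWitnessFalse; toWitnessFalse)
open import Relation.Binary.PropositionalEquality using (_≡_; _≢_; refl; sym; trans; cong; subst; subst₂)

private variable a b k : ℕ

image : (Fin a → Fin b) → Subset a → Subset b
image f []            = ⊥
image f (inside ∷ S)  = ⁅ f zero ⁆ ∪ image (f ∘ suc) S
image f (outside ∷ S) = image (f ∘ suc) S

∈-image : ∀ (f : Fin a → Fin b) {S x} → x ∈ S → f x ∈ image f S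
∈-image f {inside ∷ S}  here         = p⊆p∪q (image (f ∘ suc) S) (x∈⁅x⁆ (f zero))
∈-image f {inside ∷ S}  (there x∈S)  = q⊆p∪q ⁅ f zero ⁆ _ (∈-image (f ∘ suc) x∈S)
∈-image f {outside ∷ S} (there x∈S)  = ∈-image (f ∘ suc) x∈S

∈-image⁻ : ∀ (f : Fin a → Fin b) S {y} → y ∈ image f S → ∃ λ x → x ∈ S × f x ≡ y
∈-image⁻ f [] y∈ = contradiction y∈ ∉⊥
∈-image⁻ f (inside ∷ S) y∈ with x∈p∪q⁻ ⁅ f zero ⁆ (image (f ∘ suc) S) y∈
... | inj₁ y∈⁅f0⁆ = zero , here , sym (x∈⁅y⁆⇒x≡y (f zero) y∈⁅f0⁆)
... | inj₂ y∈rest with ∈-image⁻ (f ∘ suc) S y∈rest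
...   | x , x∈S , fx≡y = suc x , there x∈S , fx≡y
∈-image⁻ f (outside ∷ S) y∈ with ∈-image⁻ (f ∘ suc) S y∈
... | x , x∈S , fx≡y = suc x , there x∈S , fx≡y

InjectiveOn : (Fin a → Fin b) → Subset a → Set
InjectiveOn f S = ∀ {x y} → x ∈ S → y ∈ S → f x ≡ f y → x ≡ y

∣p∣≤∣q∣-by-injection : ∀ (f : Fin a → Fin b) {p q} →
  (∀ {x} → x ∈ p → f x ∈ q) → InjectiveOn f p → ∣ p ∣ ≤ ∣ q ∣
∣p∣≤∣q∣-by-injection f {[]} into inj = z≤n
∣p∣≤∣q∣-by-injection f {outside ∷ p} into inj =
  ∣p∣≤∣q∣-by-injection (f ∘ suc) (into ∘ there)
    λ x∈ y∈ e → suc-injective (inj (there x∈) (there y∈) e)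
∣p∣≤∣q∣-by-injection f {inside ∷ p} {q} into inj =
  ≤-trans (s≤s (∣p∣≤∣q∣-by-injection (f ∘ suc) {q = q - f zero} into′ inj′))
          (x∈p⇒∣p-x∣<∣p∣ (into here))
  where
  inj′ : InjectiveOn (f ∘ suc) p
  inj′ x∈ y∈ e = suc-injective (inj (there x∈) (there y∈) e)
  into′ : ∀ {x} → x ∈ p → f (suc x) ∈ q - f zero
  into′ x∈ = x∈p∧x≢y⇒x∈p-y (into (there x∈)) λ e → 0≢1+n (sym (inj (there x∈) here e))

Independent : (Fin k → Fin k → Bool) → Subset k → Set
Independent A S = ∀ {i j} → i ∈ S → j ∈ S → ¬ T (A i j)

T-not⇒¬T : ∀ {c} → T (not c) → ¬ T c
T-not⇒¬T {false} _ ()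

¬T⇒T-not : ∀ {c} → ¬ T c → T (not c)
¬T⇒T-not {false} _ = _
¬T⇒T-not {true} ¬t = ¬t _

independent?-sound : ∀ (A : Fin k → Fin k → Bool) S → T (independent? A S) → Independent A S
independent?-sound {k} A S indep {i} {j} i∈S j∈S
  with All.lookup (all⁺ _ (allFin k) (All.lookup (all⁺ _ (allFin k) indep) (∈-allFin i))) (∈-allFin j)
... | entry rewrite []=⇒lookup i∈S | []=⇒lookup j∈S = T-not⇒¬T entry

independent?-complete : ∀ (A : Fin k → Fin k → Bool) S → Independent A S → T (independent? A S)
independent?-complete {k} A S I =
  all⁻ _ {allFin k} (All.tabulate λ {i} _ → all⁻ _ {allFin k} (All.tabulate λ {j} _ → pair i j))
  where
  pair : ∀ i j → T (not (lookup S i ∧ lookup S j ∧ A i j))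
  pair i j with lookup S i in i∈S | lookup S j in j∈S
  ... | false | _     = _
  ... | true  | false = _
  ... | true  | true  = ¬T⇒T-not (I (lookup⇒[]= i S i∈S) (lookup⇒[]= j S j∈S))

∈-subsets : ∀ (S : Subset k) → S List.∈ subsets k
∈-subsets []            = Any.here refl
∈-subsets (inside ∷ S)  = ∈-++⁺ˡ (∈-map⁺ (inside ∷_) (∈-subsets S))
∈-subsets (outside ∷ S) = ∈-++⁺ʳ _ (∈-map⁺ (outside ∷_) (∈-subsets S))

αRaw-upper : ∀ (A : Fin k → Fin k → Bool) {m} →
  (∀ S → Independent A S → ∣ S ∣ ≤ m) → αRaw k A ≤ m
αRaw-upper {k} A {m} bound =
  foldr-preservesᵇ {P = _≤ m} {f = _⊔_} ⊔-lub z≤n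
    (All-map⁺ {xs = subsets k} (All.tabulate λ {S} _ → candidate≤m S))
  where
  candidate≤m : ∀ S → (if independent? A S then ∣ S ∣ else 0) ≤ m
  candidate≤m S with independent? A S | independent?-sound A S
  ... | true  | sound = bound S (sound _)
  ... | false | _     = z≤n

αRaw-lower : ∀ (A : Fin k → Fin k → Bool) {S} → Independent A S → ∣ S ∣ ≤ αRaw k A
αRaw-lower {k} A {S} I =
  foldr-preservesᵒ ≤⊔ 0 _ (inj₂ (Any-map⁺ (lose (∈-subsets S) ∣S∣≤candidate)))
  where
  ≤⊔ : ∀ x y → ∣ S ∣ ≤ x ⊎ ∣ S ∣ ≤ y → ∣ S ∣ ≤ x ⊔ y
  ≤⊔ x y = [ m≤n⇒m≤n⊔o y , m≤n⇒m≤o⊔n x ]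
  ∣S∣≤candidate : ∣ S ∣ ≤ (if independent? A S then ∣ S ∣ else 0)
  ∣S∣≤candidate with independent? A S | independent?-complete A S I
  ... | true | _ = ≤-refl

AdjOrEq : (Fin k → Fin k → Bool) → Fin k → Fin k → Set
AdjOrEq A x y = x ≡ y ⊎ T (A x y)

-- A homomorphism from the complement of A to the complement of B, stated
-- contrapositively.
record ComplementHom (A : Fin a → Fin a → Bool) (B : Fin b → Fin b → Bool) : Set where
  field
    map         : Fin a → Fin b
    fibre-adj   : ∀ {x y} → map x ≡ map y → AdjOrEq A x y
    reflect-adj : ∀ {x y} → T (B (map x) (map y)) → T (A x y)

  reflect-adjOrEq : ∀ {x y} → AdjOrEq B (map x) (map y) → AdjOrEq A x y
  reflect-adjOrEq = [ fibre-adj , inj₂ ∘ reflect-adj ]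

αRaw-mono : ∀ {A : Fin a → Fin a → Bool} {B : Fin b → Fin b → Bool} →
  ComplementHom A B → αRaw a A ≤ αRaw b B
αRaw-mono {A = A} {B} h = αRaw-upper A λ S I →
  ≤-trans (∣p∣≤∣q∣-by-injection map (∈-image map) (injectiveOn I))
          (αRaw-lower B (image-independent S I))
  where
  open ComplementHom h
  injectiveOn : ∀ {S} → Independent A S → InjectiveOn map S
  injectiveOn I x∈ y∈ e = [ id , (λ t → contradiction t (I x∈ y∈)) ] (fibre-adj e)
  image-independent : ∀ S → Independent A S → Independent B (image map S)
  image-independent S I i∈ j∈ with ∈-image⁻ map S i∈ | ∈-image⁻ map S j∈
  ... | x , x∈S , refl | y , y∈S , refl = I x∈S y∈S ∘ reflect-adj

T-==∨ : ∀ {x y : Fin k} {c} → T ((x == y) ∨ c) ⇔ (x ≡ y ⊎ T c)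
T-==∨ = (mk⇔ toWitness fromWitness ⊎-⇔ ⇔-id _) ⇔-∘ T-∨

⊠fst : (G W : Graph) → Fin (n G * n W) → Fin (n G)
⊠fst G W p = proj₁ (remQuot (n W) p)

⊠snd : (G W : Graph) → Fin (n G * n W) → Fin (n W)
⊠snd G W p = proj₂ (remQuot {n G} (n W) p)

⊠adj-unfold : ∀ G W p q → ⊠adj G W p q ≡
  not (p == q) ∧ ((⊠fst G W p == ⊠fst G W q) ∨ adj G (⊠fst G W p) (⊠fst G W q))
               ∧ ((⊠snd G W p == ⊠snd G W q) ∨ adj W (⊠snd G W p) (⊠snd G W q))
⊠adj-unfold G W p q with remQuot {n G} (n W) p | remQuot {n G} (n W) q
... | _ | _ = refl

T-⊠adj : ∀ G W {p q} → T (⊠adj G W p q) ⇔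
  (p ≢ q × AdjOrEq (adj G) (⊠fst G W p) (⊠fst G W q) × AdjOrEq (adj W) (⊠snd G W p) (⊠snd G W q))
T-⊠adj G W {p} {q} rewrite ⊠adj-unfold G W p q =
  (mk⇔ toWitnessFalse fromWitnessFalse ×-⇔ ((T-==∨ ×-⇔ T-==∨) ⇔-∘ T-∧)) ⇔-∘ T-∧ {not (p == q)}

⊠-complementHom : ∀ {G G′} W → ComplementHom (adj G′) (adj G) → ComplementHom (⊠adj G′ W) (⊠adj G W)
⊠-complementHom {G} {G′} W h = record { map = F ; fibre-adj = fibre-adj ; reflect-adj = reflect-adj }
  where
  module h = ComplementHom h

  F : Fin (n G′ * n W) → Fin (n G * n W)
  F p = combine (h.map (⊠fst G′ W p)) (⊠snd G′ W p)

  ⊠fst-F : ∀ p → ⊠fst G W (F p) ≡ h.map (⊠fst G′ W p)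
  ⊠fst-F p = cong proj₁ (remQuot-combine (h.map (⊠fst G′ W p)) (⊠snd G′ W p))

  ⊠snd-F : ∀ p → ⊠snd G W (F p) ≡ ⊠snd G′ W p
  ⊠snd-F p = cong proj₂ (remQuot-combine (h.map (⊠fst G′ W p)) (⊠snd G′ W p))

  fibre-adj : ∀ {p q} → F p ≡ F q → AdjOrEq (⊠adj G′ W) p q
  fibre-adj {p} {q} Fp≡Fq with toSum (p ≟ q)
  ... | inj₁ p≡q = inj₁ p≡q
  ... | inj₂ p≢q = inj₂ (Equivalence.from (T-⊠adj G′ W) (p≢q , h.fibre-adj fst≡ , inj₁ snd≡))
    where
    fst≡ : h.map (⊠fst G′ W p) ≡ h.map (⊠fst G′ W q)
    fst≡ = trans (sym (⊠fst-F p)) (trans (cong (⊠fst G W) Fp≡Fq) (⊠fst-F q))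
    snd≡ : ⊠snd G′ W p ≡ ⊠snd G′ W q
    snd≡ = trans (sym (⊠snd-F p)) (trans (cong (⊠snd G W) Fp≡Fq) (⊠snd-F q))

  reflect-adj : ∀ {p q} → T (⊠adj G W (F p) (F q)) → T (⊠adj G′ W p q)
  reflect-adj {p} {q} t with Equivalence.to (T-⊠adj G W) t
  ... | Fp≢Fq , fst-adj , snd-adj = Equivalence.from (T-⊠adj G′ W)
    ( Fp≢Fq ∘ cong F
    , h.reflect-adjOrEq (subst₂ (AdjOrEq (adj G)) (⊠fst-F p) (⊠fst-F q) fst-adj)
    , subst₂ (AdjOrEq (adj W)) (⊠snd-F p) (⊠snd-F q) snd-adj )

α⊠-mono : ∀ {G G′} W → ComplementHom (adj G′) (adj G) → α⊠ G′ W ≤ α⊠ G W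
α⊠-mono {G} {G′} W = αRaw-mono ∘ ⊠-complementHom {G} {G′} W

iso-complementHom : ∀ {G G′} → Iso G G′ → ComplementHom (adj G′) (adj G)
iso-complementHom {G} {G′} (f , adj-to) = record
  { map         = from
  ; fibre-adj   = λ {x} {y} e →
      inj₁ (trans (sym (strictlyInverseˡ x)) (trans (cong to e) (strictlyInverseˡ y)))
  ; reflect-adj = λ {x} {y} → subst T (adj-from x y)
  }
  where
  open Inverse f
  adj-from : ∀ x y → adj G (from x) (from y) ≡ adj G′ x y
  adj-from x y = sym (subst₂ (λ u v → adj G′ u v ≡ adj G (from x) (from y))
                             (strictlyInverseˡ x) (strictlyInverseˡ y) (adj-to (from x) (from y)))

delete-complementHom : ∀ {G G′} → DeleteVertex G G′ → ComplementHom (adj G′) (adj G)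
delete-complementHom (_ , ι , ι-injective , _ , _ , adj-ι) = record
  { map         = ι
  ; fibre-adj   = inj₁ ∘ ι-injective _ _
  ; reflect-adj = subst T (sym (adj-ι _ _))
  }

addEdge-complementHom : ∀ {G G′} → AddEdge G G′ → ComplementHom (adj G′) (adj G)
addEdge-complementHom (refl , _ , _ , _ , _ , adj′) = record
  { map         = id
  ; fibre-adj   = inj₁
  ; reflect-adj = λ t → subst T (sym (adj′ _ _)) (Equivalence.from T-∨ (inj₁ t))
  }

clique-complementHom : ∀ {G G′} → ReplaceByClique G G′ → ComplementHom (adj G′) (adj G)
clique-complementHom {G} {G′} (_ , π , _ , _ , adj-π) = record
  { map = π ; fibre-adj = fibre-adj ; reflect-adj = reflect-adj }
  where
  fibre-adj : ∀ {x y} → π x ≡ π y → AdjOrEq (adj G′) x y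
  fibre-adj {x} {y} e with toSum (x ≟ y)
  ... | inj₁ x≡y = inj₁ x≡y
  ... | inj₂ x≢y = inj₂ (subst T (sym (adj-π x y x≢y)) (Equivalence.from T-==∨ (inj₁ e)))
  reflect-adj : ∀ {x y} → T (adj G (π x) (π y)) → T (adj G′ x y)
  reflect-adj {x} {y} t with toSum (x ≟ y)
  ... | inj₁ refl = contradiction t (subst T (irrefl G (π x)))
  ... | inj₂ x≢y  = subst T (sym (adj-π x y x≢y)) (Equivalence.from T-==∨ (inj₂ t))

mainTheorem3 : ∀ (G H : Graph) → Expand H G → α*≤1 G H
mainTheorem3 G H G∈Expand W _ = α⊠-antitone G∈Expand
  where
  α⊠-antitone : ∀ {G′} → Expand H G′ → α⊠ G′ W ≤ α⊠ H W
  step : ∀ {G₀} G₁ → Expand H G₀ → ComplementHom (adj G₁) (adj G₀) → α⊠ G₁ W ≤ α⊠ H W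
  step {G₀} G₁ e h = ≤-trans (α⊠-mono {G₀} {G₁} W h) (α⊠-antitone e)

  α⊠-antitone base                   = ≤-refl
  α⊠-antitone (iso    {G₀} {G₁} e f) = step G₁ e (iso-complementHom {G₀} {G₁} f)
  α⊠-antitone (delete {G₀} {G₁} e d) = step G₁ e (delete-complementHom {G₀} {G₁} d)
  α⊠-antitone (addE   {G₀} {G₁} e d) = step G₁ e (addEdge-complementHom {G₀} {G₁} d)
  α⊠-antitone (clique {G₀} {G₁} e c) = step G₁ e (clique-complementHom {G₀} {G₁} c)
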